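{- Let $\mathcal{H}$ be the $k$-vector space with basis the packed words, and define $\Delta:\mathcal{H}\to\mathcal{H}\otimes\mathcal{H}$ on packed words by $$\Delta(w)=\sum_{I\cup J=[1\dots|w|],\ I\cap J=\emptyset} pack(w[I])\otimes pack\big({}^{w[J]}/_{w[I]}\big),$$ the sum running over ordered pairs $(I,J)$, extended linearly, and $\epsilon:\mathcal{H}\to k$ by $\epsilon(1_{X^*})=1$ and $\epsilon(w)=0$ for every non-empty packed word $w$. Then $(\mathcal{H},\Delta,\epsilon)$ is a coassociative coalgebra with counit $\epsilon$.
   Context: Let $k$ be a field, $X=\{x_i\}_{i\ge 0}$ an alphabet indexed by the nonnegative integers and $X^*$ the set of words over $X$, with empty word $1_{X^*}$. For a word $w=x_{i_1}\cdots x_{i_m}$, $|w|=m$, $w[j]$ is its $j$-th letter, $Alph(w)$ the set of letters occurring in $w$, $IAlph(w)=\{i_1,\dots,i_m\}$; for $\phi$ on $IAlph(w)$ with values in $\mathbb{N}$ and $\phi(0)=0$, $S_\phi(w)=x_{\phi(i_1)}\cdots x_{\phi(i_m)}$. If $IAlph(w)\setminus\{0\}=\{j_1<\dots<j_k\}$, let $\phi_w(j_m)=m$, $\phi_w(0)=0$, $pack(w)=S_{\phi_w}(w)$; $w$ is packed if $pack(w)=w$. For $L=\{l_1<\dots<l_r\}\subseteq[1\dots|w|]$, $w[L]=w[l_1]\cdots w[l_r]$. For $A\subseteq X$, $w/A=S_{\phi_A}(w)$ where $\phi_A(i)=0$ if $x_i\in A$ and $\phi_A(i)=i$ otherwise;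 for words $w,u$, ${}^{w}/_{u}=w/Alph(u)$. -}

module Defs where

open import Level using (Level; _⊔_) renaming (suc to lsuc)
open import Data.Bool using (Bool; true; false; not; if_then_else_)
open import Data.Nat using (ℕ; zero; suc; _≤?_)
import Data.Nat.Properties as ℕP
open import Data.List using (List; []; _∷_; map; length; filter; upTo; concatMap; foldr)
open import Data.List.Properties using (≡-dec)
open import Data.List.Relation.Unary.Any using (any?)
open import Data.Product using (Σ; _×_; _,_; ∃; proj₁)
open import Relation.Nullary using (¬_; Dec; yes; no; does)
open import Relation.Binary.PropositionalEquality using (_≡_)
open import Algebra.Bundles using (CommutativeRing)

-- Words over X = {x_i}_{i≥0}: the letter x_i is represented by i.

Word : Set
Word = List ℕ

_≟w_ : (u v : Word) → Dec (u ≡ v)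
_≟w_ = ≡-dec ℕP._≟_

occurs : ℕ → Word → Bool
occurs i w = does (any? (ℕP._≟_ i) w)

-- φ_w(i) = number of j ∈ IAlph(w) with 1 ≤ j ≤ i  (so φ_w(0) = 0 and
-- φ_w(j_m) = m when IAlph(w)∖{0} = {j_1 < … < j_k})
φ : Word → ℕ → ℕ
φ w i = length (filter (λ j → occurs j w ≟b true) (map suc (upTo i)))
  where
  _≟b_ : (a b : Bool) → Dec (a ≡ b)
  _≟b_ = Data.Bool._≟_
    where import Data.Bool

S : (ℕ → ℕ) → Word → Word
S f w = map f w

pack : Word → Word
pack w = S (φ w) w

IsPacked : Word → Set
IsPacked w = pack w ≡ w

PackedWord : Set
PackedWord = Σ Word IsPacked

_/w_ : Word → Word → Word
w /w u = S (λ i → if occurs i u then 0 else i) w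

-- Subsets of [1 … n] as characteristic lists of length n
-- (position j is in the subset iff the j-th entry is true).

subsets : ℕ → List (List Bool)
subsets zero    = [] ∷ []
subsets (suc n) = concatMap (λ s → (true ∷ s) ∷ (false ∷ s) ∷ []) (subsets n)

restrict : List Bool → Word → Word
restrict []          _       = []
restrict (_ ∷ _)     []      = []
restrict (true ∷ L)  (a ∷ w) = a ∷ restrict L w
restrict (false ∷ L) (a ∷ w) = restrict L w

Δterms : Word → List (Word × Word)
Δterms w = map (λ I → pack (restrict I w)
                    , pack (restrict (map not I) w /w restrict I w))
               (subsets (length w))

record Field (c ℓ : Level) : Set (lsuc (c ⊔ ℓ)) where
  field
    commutativeRing : CommutativeRing c ℓ
  open CommutativeRing commutativeRing public
  field
    1≉0     : ¬ (1# ≈ 0#)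
    inverse : ∀ x → ¬ (x ≈ 0#) → ∃ λ y → x * y ≈ 1#

module Coalgebra {c ℓ : Level} (F : Field c ℓ) where
  open Field F

  -- element of 𝓗 : finite k-linear combination of packed words
  H : Set c
  H = List (Carrier × PackedWord)

  -- elements of k-linear combinations of words, of pairs, of triples
  T₁ T₂ T₃ : Set c
  T₁ = List (Carrier × Word)
  T₂ = List (Carrier × Word × Word)
  T₃ = List (Carrier × Word × Word × Word)

  ι : H → T₁
  ι = map (λ { (a , w) → a , proj₁ w })

  coeff₁ : T₁ → Word → Carrier
  coeff₁ t u = foldr (λ { (a , w) r → (if does (w ≟w u) then a else 0#) + r }) 0# t

  coeff₃ : T₃ → Word → Word → Word → Carrier
  coeff₃ t u v z = foldr (λ { (a , x , y , q) r →
      (if does (x ≟w u) then (if does (y ≟w v) then (if does (q ≟w z) then a else 0#) else 0#) else 0#) + r }) 0# t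

  _≈₁_ : T₁ → T₁ → Set ℓ
  s ≈₁ t = ∀ u → coeff₁ s u ≈ coeff₁ t u

  _≈₃_ : T₃ → T₃ → Set ℓ
  s ≈₃ t = ∀ u v z → coeff₃ s u v z ≈ coeff₃ t u v z

  Δ : H → T₂
  Δ = concatMap (λ { (a , w) → map (λ { (x , y) → a , x , y }) (Δterms (proj₁ w)) })

  Δ⊗id : T₂ → T₃
  Δ⊗id = concatMap (λ { (a , u , v) → map (λ { (x , y) → a , x , y , v }) (Δterms u) })

  id⊗Δ : T₂ → T₃
  id⊗Δ = concatMap (λ { (a , u , v) → map (λ { (x , y) → a , u , x , y }) (Δterms v) })

  εw : Word → Carrier
  εw []      = 1#
  εw (_ ∷ _) = 0#

  -- ε ⊗ id : 𝓗 ⊗ 𝓗 → k ⊗ 𝓗 ≅ 𝓗   and   id ⊗ ε : 𝓗 ⊗ 𝓗 → 𝓗 ⊗ k ≅ 𝓗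
  ε⊗id : T₂ → T₁
  ε⊗id = map (λ { (a , u , v) → a * εw u , v })

  id⊗ε : T₂ → T₁
  id⊗ε = map (λ { (a , u , v) → a * εw v , u })

module Submission where

-- Both (Δ ⊗ id)(Δ w) and (id ⊗ Δ)(Δ w) are sums indexed by
-- the colourings c of the positions of w with three colours (which tensor
-- factor each letter ends up in).  Writing w₁, w₂, w₃ for the subwords of
-- each colour, the term of c is on both sides
--     pack w₁ ⊗ pack (w₂ / w₁) ⊗ pack ((w₃ / w₁) / (w₂ / w₁)).
-- This rests on two facts.  Packing is blind to a preliminary packing:
-- pack (pack(Y)[K]) = pack (Y[K]), and similarly for quotients, because the
-- packing map of Y is an order-preserving injection on the letters of Y.
-- Successive quotients compose: (x/a)/(y/a) = x/(a ∪ y).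
-- The index lists of the two double sums are permutations of the list of
-- colourings, and coefficients are invariant under permutation.
--
-- Counit.  ε(w[I]) vanishes unless I = ∅, and ε(w[J]) unless J = ∅; the
-- surviving terms are 1 ⊗ pack w and pack w ⊗ 1, and pack w = w for packed w.

open import Defs
open import Level using (Level)
open import Data.Bool using (Bool; true; false; not; if_then_else_; _∨_)
import Data.Bool as Bool
open import Data.Bool.Properties using (∨-assoc)
open import Data.Nat using (ℕ; zero; suc; _≤_; _<_; z≤n; s≤s; _≟_)
open import Data.Nat.Properties
  using (≤-refl; ≤-trans; <-cmp; <⇒≢; n≤1+n; m≤n⇒m<n∨m≡n; +-comm; +-identityʳ)
open import Data.List using (List; []; _∷_; map; length; filter; upTo; concatMap; replicate; _++_; [_])
open import Data.List.Properties
  using (filter-++; length-++; length-map; applyUpTo-∷ʳ; map-++; map-cong; map-cong-local; map-∘; map-id;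
         map-replicate; concatMap-++; concatMap-map; concatMap-cong; concatMap-pure; map-concatMap;
         ++-identityʳ)
  renaming (++-assoc to ++-assoc-≡)
open import Data.List.Membership.Propositional using (_∈_; _∉_)
open import Data.List.Membership.DecPropositional _≟_ using (_∈?_)
open import Data.List.Membership.Propositional.Properties using (∈-map⁺; ∈-map⁻)
open import Data.List.Relation.Unary.Any using (here; there; any?)
import Data.List.Relation.Unary.All as All
open import Data.List.Relation.Binary.Subset.Propositional using (_⊆_)
import Data.List.Relation.Binary.Permutation.Propositional as ↭
open import Data.List.Relation.Binary.Permutation.Propositional
  using (_↭_; ↭-refl; ↭-reflexive; ↭-trans; module PermutationReasoning)
open import Data.List.Relation.Binary.Permutation.Propositional.Properties
  using (++⁺; ++⁺ˡ; shifts; map⁺)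
open import Data.Product using (_×_; _,_; uncurry)
open import Data.Sum using (_⊎_; inj₁; inj₂)
open import Data.Empty using (⊥-elim)
open import Function using (_∘_; id)
open import Function.Bundles using (mk⇔)
open import Relation.Nullary using (Dec; yes; no; does)
open import Relation.Nullary.Decidable using (dec-true; dec-false; does-⇔)
open import Relation.Unary using (Pred) renaming (Decidable to DecidablePred)
open import Relation.Binary using (tri<; tri≈; tri>)
open import Relation.Binary.PropositionalEquality hiding ([_])
import Algebra.Properties.CommutativeSemigroup as CommutativeSemigroupProperties

module _ {a b c : Level} {A : Set a} {B : Set b} {C : Set c} where

  concatMap-concatMap : ∀ (g : B → List C) (f : A → List B) xs →
    concatMap g (concatMap f xs) ≡ concatMap (concatMap g ∘ f) xs
  concatMap-concatMap g f []       = refl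
  concatMap-concatMap g f (x ∷ xs) =
    trans (concatMap-++ g (f x) (concatMap f xs)) (cong (concatMap g (f x) ++_) (concatMap-concatMap g f xs))

module _ {a b : Level} {A : Set a} {B : Set b} where

  concatMap⁺ : ∀ (f : A → List B) {xs ys} → xs ↭ ys → concatMap f xs ↭ concatMap f ys
  concatMap⁺ f ↭.refl         = ↭-refl
  concatMap⁺ f (↭.prep x p)   = ++⁺ˡ (f x) (concatMap⁺ f p)
  concatMap⁺ f (↭.swap x y p) =
    ↭-trans (shifts (f x) (f y)) (++⁺ˡ (f y) (++⁺ˡ (f x) (concatMap⁺ f p)))
  concatMap⁺ f (↭.trans p q)  = ↭-trans (concatMap⁺ f p) (concatMap⁺ f q)

  concatMap-pointwise : ∀ {f g : A → List B} xs → (∀ x → f x ↭ g x) → concatMap f xs ↭ concatMap g xs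
  concatMap-pointwise []       f↭g = ↭-refl
  concatMap-pointwise (x ∷ xs) f↭g = ++⁺ (f↭g x) (concatMap-pointwise xs f↭g)

  concatMap-interleave : ∀ (f g : A → List B) xs →
    concatMap f xs ++ concatMap g xs ↭ concatMap (λ x → f x ++ g x) xs
  concatMap-interleave f g []       = ↭-refl
  concatMap-interleave f g (x ∷ xs) = begin
    (f x ++ concatMap f xs) ++ g x ++ concatMap g xs   ≡⟨ ++-assoc-≡ (f x) (concatMap f xs) _ ⟩
    f x ++ concatMap f xs ++ g x ++ concatMap g xs     ↭⟨ ++⁺ˡ (f x) (shifts (concatMap f xs) (g x)) ⟩
    f x ++ g x ++ concatMap f xs ++ concatMap g xs     ≡⟨ ++-assoc-≡ (f x) (g x) _ ⟨
    (f x ++ g x) ++ concatMap f xs ++ concatMap g xs   ↭⟨ ++⁺ˡ (f x ++ g x) (concatMap-interleave f g xs) ⟩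
    (f x ++ g x) ++ concatMap (λ y → f y ++ g y) xs    ∎
    where open PermutationReasoning

  map-as-concatMap : ∀ (f : A → B) xs → map f xs ≡ concatMap (λ x → [ f x ]) xs
  map-as-concatMap f xs = trans (sym (concatMap-pure (map f xs))) (concatMap-map [_] f xs)

occurs-∈ : ∀ {i w} → i ∈ w → occurs i w ≡ true
occurs-∈ {i} {w} = dec-true (any? (i ≟_) w)

occurs-∉ : ∀ {i w} → i ∉ w → occurs i w ≡ false
occurs-∉ {i} {w} = dec-false (any? (i ≟_) w)

occurs-⇔ : ∀ {i j t s} → (i ∈ t → j ∈ s) → (j ∈ s → i ∈ t) → occurs i t ≡ occurs j s
occurs-⇔ {i} {j} {t} {s} to from = does-⇔ (mk⇔ to from) (any? (i ≟_) t) (any? (j ≟_) s)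

-- The packing map, computed letter by letter: rank Y i = #{1 ≤ j ≤ i : j ∈ Y},
-- so that pack Y = map (rank Y) Y.

bump : Bool → ℕ → ℕ
bump b n = if b then suc n else n

rank : Word → ℕ → ℕ
rank Y zero    = zero
rank Y (suc i) = bump (occurs (suc i) Y) (rank Y i)

length-filter-∷ʳ : ∀ {p} {P : Pred ℕ p} (P? : DecidablePred P) xs x →
  length (filter P? (xs ++ [ x ])) ≡ bump (does (P? x)) (length (filter P? xs))
length-filter-∷ʳ P? xs x
  rewrite filter-++ P? xs [ x ] | length-++ (filter P? xs) {filter P? [ x ]}
  with does (P? x)
... | true  = +-comm (length (filter P? xs)) 1
... | false = +-identityʳ (length (filter P? xs))

does-≟-true : ∀ b → does (b Bool.≟ true) ≡ b
does-≟-true true  = refl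
does-≟-true false = refl

φ≗rank : ∀ Y i → φ Y i ≡ rank Y i
φ≗rank Y zero    = refl
φ≗rank Y (suc i) = begin
  length (filter P? (map suc (upTo (suc i))))
    ≡⟨ cong (length ∘ filter P? ∘ map suc) (sym (applyUpTo-∷ʳ id i)) ⟩
  length (filter P? (map suc (upTo i ++ [ i ])))
    ≡⟨ cong (length ∘ filter P?) (map-++ suc (upTo i) [ i ]) ⟩
  length (filter P? (map suc (upTo i) ++ [ suc i ]))
    ≡⟨ length-filter-∷ʳ P? (map suc (upTo i)) (suc i) ⟩
  bump (does (P? (suc i))) (φ Y i)
    ≡⟨ cong₂ bump (does-≟-true (occurs (suc i) Y)) (φ≗rank Y i) ⟩
  bump (occurs (suc i) Y) (rank Y i) ∎
  where
  open ≡-Reasoning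
  P? : ∀ j → Dec (occurs j Y ≡ true)
  P? j = occurs j Y Bool.≟ true

pack≡map-rank : ∀ w → pack w ≡ map (rank w) w
pack≡map-rank w = map-cong (φ≗rank w) w

bump-≤ : ∀ b n → n ≤ bump b n
bump-≤ true  n = n≤1+n n
bump-≤ false n = ≤-refl

rank-mono : ∀ Y {a b} → a ≤ b → rank Y a ≤ rank Y b
rank-mono Y {b = zero} z≤n = ≤-refl
rank-mono Y {a} {suc b} a≤1+b with m≤n⇒m<n∨m≡n a≤1+b
... | inj₂ refl       = ≤-refl
... | inj₁ (s≤s a≤b) = ≤-trans (rank-mono Y a≤b) (bump-≤ (occurs (suc b) Y) (rank Y b))

rank-step : ∀ {Y j} → suc j ∈ Y → rank Y (suc j) ≡ suc (rank Y j)
rank-step {Y} {j} 1+j∈Y rewrite occurs-∈ 1+j∈Y = refl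

rank-skip : ∀ {Y j} → suc j ∉ Y → rank Y (suc j) ≡ rank Y j
rank-skip {Y} {j} 1+j∉Y rewrite occurs-∉ 1+j∉Y = refl

-- The letters a packing may legitimately be applied to: 0 and the letters of Y.
Supported : Word → ℕ → Set
Supported Y k = k ≡ 0 ⊎ k ∈ Y

_⊑_ : Word → Word → Set
t ⊑ Y = ∀ {k} → k ∈ t → Supported Y k

rank-strict : ∀ Y {a b} → a < b → Supported Y b → rank Y a < rank Y b
rank-strict Y (s≤s a≤j) (inj₂ 1+j∈Y) rewrite rank-step 1+j∈Y = s≤s (rank-mono Y a≤j)

rank-injective : ∀ Y {k i} → Supported Y k → Supported Y i → rank Y k ≡ rank Y i → k ≡ i
rank-injective Y {k} {i} sk si eq with <-cmp k i
... | tri< k<i _ _ = ⊥-elim (<⇒≢ (rank-strict Y k<i si) eq)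
... | tri≈ _ k≡i _ = k≡i
... | tri> _ _ i<k = ⊥-elim (<⇒≢ (rank-strict Y i<k sk) (sym eq))

occurs-relabel : ∀ Y {t i} → t ⊑ Y → Supported Y i →
  occurs (rank Y i) (map (rank Y) t) ≡ occurs i t
occurs-relabel Y {t} {i} t⊑Y si = occurs-⇔ from (∈-map⁺ (rank Y))
  where
  from : rank Y i ∈ map (rank Y) t → i ∈ t
  from ri∈ with ∈-map⁻ (rank Y) ri∈
  ... | k , k∈t , eq rewrite rank-injective Y si (t⊑Y k∈t) eq = k∈t

rank-relabel : ∀ Y {t} → t ⊑ Y → ∀ i → rank (map (rank Y) t) (rank Y i) ≡ rank t i
rank-relabel Y t⊑Y zero = refl
rank-relabel Y {t} t⊑Y (suc i) = by-cases (suc i ∈? Y)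
  where
  open ≡-Reasoning
  g : ℕ → ℕ
  g = rank Y
  by-cases : Dec (suc i ∈ Y) → rank (map g t) (g (suc i)) ≡ rank t (suc i)
  by-cases (yes 1+i∈Y) = begin
    rank (map g t) (g (suc i))
      ≡⟨ cong (rank (map g t)) (rank-step 1+i∈Y) ⟩
    bump (occurs (suc (g i)) (map g t)) (rank (map g t) (g i))
      ≡⟨ cong₂ bump occ (rank-relabel Y t⊑Y i) ⟩
    bump (occurs (suc i) t) (rank t i) ∎
    where
    occ : occurs (suc (g i)) (map g t) ≡ occurs (suc i) t
    occ = trans (cong (λ j → occurs j (map g t)) (sym (rank-step 1+i∈Y)))
                (occurs-relabel Y t⊑Y (inj₂ 1+i∈Y))
  by-cases (no 1+i∉Y) = begin
    rank (map g t) (g (suc i))  ≡⟨ cong (rank (map g t)) (rank-skip 1+i∉Y) ⟩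
    rank (map g t) (g i)        ≡⟨ rank-relabel Y t⊑Y i ⟩
    rank t i                    ≡⟨ rank-skip 1+i∉t ⟨
    rank t (suc i)              ∎
    where
    1+i∉t : suc i ∉ t
    1+i∉t 1+i∈t with t⊑Y 1+i∈t
    ... | inj₂ 1+i∈Y = 1+i∉Y 1+i∈Y

pack-relabel : ∀ Y {t} → t ⊑ Y → pack (map (rank Y) t) ≡ pack t
pack-relabel Y {t} t⊑Y = begin
  pack (map (rank Y) t)                        ≡⟨ pack≡map-rank (map (rank Y) t) ⟩
  map (rank (map (rank Y) t)) (map (rank Y) t) ≡⟨ map-∘ t ⟨
  map (rank (map (rank Y) t) ∘ rank Y) t       ≡⟨ map-cong (rank-relabel Y t⊑Y) t ⟩
  map (rank t) t                               ≡⟨ pack≡map-rank t ⟨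
  pack t                                       ∎
  where open ≡-Reasoning

erase : Word → ℕ → ℕ
erase u i = if occurs i u then 0 else i

if-const : ∀ b (n : ℕ) → (if b then n else n) ≡ n
if-const true  n = refl
if-const false n = refl

-- A quotient only introduces the letter 0.
quotient-⊑ : ∀ {Y t} s → t ⊑ Y → (t /w s) ⊑ Y
quotient-⊑ {t = t} s t⊑Y k∈t/s with ∈-map⁻ (erase s) k∈t/s
... | x , x∈t , refl with occurs x s
...   | true  = inj₁ refl
...   | false = t⊑Y x∈t

quotient-relabel : ∀ Y {t₁ t₂} → t₁ ⊑ Y → t₂ ⊑ Y →
  (map (rank Y) t₁ /w map (rank Y) t₂) ≡ map (rank Y) (t₁ /w t₂)
quotient-relabel Y {t₁} {t₂} t₁⊑Y t₂⊑Y =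
  trans (sym (map-∘ t₁)) (trans (map-cong-local (All.tabulate (pointwise ∘ t₁⊑Y))) (map-∘ t₁))
  where
  pointwise : ∀ {x} → Supported Y x → erase (map (rank Y) t₂) (rank Y x) ≡ rank Y (erase t₂ x)
  pointwise (inj₁ refl) =
    trans (if-const (occurs 0 (map (rank Y) t₂)) 0) (sym (cong (rank Y) (if-const (occurs 0 t₂) 0)))
  pointwise {x} (inj₂ x∈Y) rewrite occurs-relabel Y t₂⊑Y (inj₂ x∈Y) with occurs x t₂
  ... | true  = refl
  ... | false = refl

occurs-quotient : ∀ {m a} y → occurs (suc m) a ≡ false → occurs (suc m) (y /w a) ≡ occurs (suc m) y
occurs-quotient {m} {a} y fresh = occurs-⇔ to from
  where
  to : suc m ∈ (y /w a) → suc m ∈ y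
  to 1+m∈ with ∈-map⁻ (erase a) 1+m∈
  ... | z , z∈y , eq with occurs z a
  ...   | false = subst (_∈ y) (sym eq) z∈y
  to 1+m∈ | z , z∈y , () | true
  from : suc m ∈ y → suc m ∈ (y /w a)
  from 1+m∈y = subst (_∈ (y /w a)) (cong (λ b → if b then 0 else suc m) fresh) (∈-map⁺ (erase a) 1+m∈y)

quotient-quotient : ∀ x a y b → (∀ i → occurs i b ≡ occurs i a ∨ occurs i y) →
  ((x /w a) /w (y /w a)) ≡ (x /w b)
quotient-quotient x a y b b≡a∪y = trans (sym (map-∘ x)) (map-cong pointwise x)
  where
  erase-0 : ∀ u → erase u 0 ≡ 0
  erase-0 u = if-const (occurs 0 u) 0
  pointwise : ∀ i → erase (y /w a) (erase a i) ≡ erase b i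
  pointwise zero = begin
    erase (y /w a) (erase a 0)  ≡⟨ cong (erase (y /w a)) (erase-0 a) ⟩
    erase (y /w a) 0            ≡⟨ erase-0 (y /w a) ⟩
    0                           ≡⟨ erase-0 b ⟨
    erase b 0                   ∎
    where open ≡-Reasoning
  pointwise (suc m) rewrite b≡a∪y (suc m) with occurs (suc m) a in fresh
  ... | true  = erase-0 (y /w a)
  ... | false = cong (λ c → if c then 0 else suc m) (occurs-quotient {m} {a} y fresh)

restrict-⊆ : ∀ K y → restrict K y ⊆ y
restrict-⊆ []          y       ()
restrict-⊆ (_ ∷ K)     []      ()
restrict-⊆ (true ∷ K)  (a ∷ y) (here refl) = here refl
restrict-⊆ (true ∷ K)  (a ∷ y) (there k∈) = there (restrict-⊆ K y k∈)
restrict-⊆ (false ∷ K) (a ∷ y) k∈         = there (restrict-⊆ K y k∈)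

restrict-⊑ : ∀ K Y → restrict K Y ⊑ Y
restrict-⊑ K Y = inj₂ ∘ restrict-⊆ K Y

restrict-map : ∀ (f : ℕ → ℕ) K y → restrict K (map f y) ≡ map f (restrict K y)
restrict-map f []          y       = refl
restrict-map f (_ ∷ K)     []      = refl
restrict-map f (true ∷ K)  (a ∷ y) = cong (f a ∷_) (restrict-map f K y)
restrict-map f (false ∷ K) (a ∷ y) = restrict-map f K y

restrict-pack : ∀ K Y → restrict K (pack Y) ≡ map (rank Y) (restrict K Y)
restrict-pack K Y = trans (cong (restrict K) (pack≡map-rank Y)) (restrict-map (rank Y) K Y)

pack-restrict-pack : ∀ K Y → pack (restrict K (pack Y)) ≡ pack (restrict K Y)
pack-restrict-pack K Y = trans (cong pack (restrict-pack K Y)) (pack-relabel Y (restrict-⊑ K Y))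

pack-quotient-pack : ∀ L K Y →
  pack (restrict L (pack Y) /w restrict K (pack Y)) ≡ pack (restrict L Y /w restrict K Y)
pack-quotient-pack L K Y = begin
  pack (restrict L (pack Y) /w restrict K (pack Y))
    ≡⟨ cong₂ (λ a b → pack (a /w b)) (restrict-pack L Y) (restrict-pack K Y) ⟩
  pack (map (rank Y) (restrict L Y) /w map (rank Y) (restrict K Y))
    ≡⟨ cong pack (quotient-relabel Y (restrict-⊑ L Y) (restrict-⊑ K Y)) ⟩
  pack (map (rank Y) (restrict L Y /w restrict K Y))
    ≡⟨ pack-relabel Y (quotient-⊑ (restrict K Y) (restrict-⊑ L Y)) ⟩
  pack (restrict L Y /w restrict K Y) ∎
  where open ≡-Reasoning

-- I ⊙ K is the selector that reads K along the selected positions of I,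
-- so that selecting K inside w[I] is selecting I ⊙ K inside w.
_⊙_ : List Bool → List Bool → List Bool
[]          ⊙ K       = []
(false ∷ I) ⊙ K       = false ∷ (I ⊙ K)
(true ∷ I)  ⊙ []      = false ∷ (I ⊙ [])
(true ∷ I)  ⊙ (b ∷ K) = b ∷ (I ⊙ K)

restrict-[] : ∀ K → restrict K [] ≡ []
restrict-[] []      = refl
restrict-[] (_ ∷ _) = refl

restrict-⊙ : ∀ I K w → restrict K (restrict I w) ≡ restrict (I ⊙ K) w
restrict-⊙ []          K           w       = restrict-[] K
restrict-⊙ (false ∷ I) K           []      = restrict-[] K
restrict-⊙ (true ∷ I)  []          []      = refl
restrict-⊙ (true ∷ I)  (_ ∷ K)     []      = refl
restrict-⊙ (false ∷ I) K           (a ∷ w) = restrict-⊙ I K w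
restrict-⊙ (true ∷ I)  []          (a ∷ w) = restrict-⊙ I [] w
restrict-⊙ (true ∷ I)  (true ∷ K)  (a ∷ w) = cong (a ∷_) (restrict-⊙ I K w)
restrict-⊙ (true ∷ I)  (false ∷ K) (a ∷ w) = restrict-⊙ I K w

-- A colouring of the positions of a word records into which tensor factor of
-- 𝓗 ⊗ 𝓗 ⊗ 𝓗 each letter is sent by an iterated coproduct.
data Colour : Set where
  first second third : Colour

isFirst isSecond isThird notThird : Colour → Bool
isFirst first = true
isFirst _     = false
isSecond second = true
isSecond _      = false
isThird third = true
isThird _     = false
notThird third = false
notThird _     = true

-- Among the positions not coloured third, those coloured first
-- (the inner splitting of (Δ ⊗ id) ∘ Δ).
selFirst : List Colour → List Bool
selFirst []           = []
selFirst (first ∷ c)  = true ∷ selFirst c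
selFirst (second ∷ c) = false ∷ selFirst c
selFirst (third ∷ c)  = selFirst c

-- Among the positions not coloured first, those coloured second
-- (the inner splitting of (id ⊗ Δ) ∘ Δ).
selSecond : List Colour → List Bool
selSecond []           = []
selSecond (first ∷ c)  = selSecond c
selSecond (second ∷ c) = true ∷ selSecond c
selSecond (third ∷ c)  = false ∷ selSecond c

notThird-⊙-selFirst : ∀ c → map notThird c ⊙ selFirst c ≡ map isFirst c
notThird-⊙-selFirst []           = refl
notThird-⊙-selFirst (first ∷ c)  = cong (true ∷_) (notThird-⊙-selFirst c)
notThird-⊙-selFirst (second ∷ c) = cong (false ∷_) (notThird-⊙-selFirst c)
notThird-⊙-selFirst (third ∷ c)  = cong (false ∷_) (notThird-⊙-selFirst c)

notThird-⊙-¬selFirst : ∀ c → map notThird c ⊙ map not (selFirst c) ≡ map isSecond c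
notThird-⊙-¬selFirst []           = refl
notThird-⊙-¬selFirst (first ∷ c)  = cong (false ∷_) (notThird-⊙-¬selFirst c)
notThird-⊙-¬selFirst (second ∷ c) = cong (true ∷_) (notThird-⊙-¬selFirst c)
notThird-⊙-¬selFirst (third ∷ c)  = cong (false ∷_) (notThird-⊙-¬selFirst c)

¬first-⊙-selSecond : ∀ c → map not (map isFirst c) ⊙ selSecond c ≡ map isSecond c
¬first-⊙-selSecond []           = refl
¬first-⊙-selSecond (first ∷ c)  = cong (false ∷_) (¬first-⊙-selSecond c)
¬first-⊙-selSecond (second ∷ c) = cong (true ∷_) (¬first-⊙-selSecond c)
¬first-⊙-selSecond (third ∷ c)  = cong (false ∷_) (¬first-⊙-selSecond c)

¬first-⊙-¬selSecond : ∀ c → map not (map isFirst c) ⊙ map not (selSecond c) ≡ map isThird c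
¬first-⊙-¬selSecond []           = refl
¬first-⊙-¬selSecond (first ∷ c)  = cong (false ∷_) (¬first-⊙-¬selSecond c)
¬first-⊙-¬selSecond (second ∷ c) = cong (false ∷_) (¬first-⊙-¬selSecond c)
¬first-⊙-¬selSecond (third ∷ c)  = cong (true ∷_) (¬first-⊙-¬selSecond c)

¬notThird : ∀ c → map not (map notThird c) ≡ map isThird c
¬notThird []           = refl
¬notThird (first ∷ c)  = cong (false ∷_) (¬notThird c)
¬notThird (second ∷ c) = cong (false ∷_) (¬notThird c)
¬notThird (third ∷ c)  = cong (true ∷_) (¬notThird c)

occurs-notThird : ∀ c w i → occurs i (restrict (map notThird c) w)
  ≡ occurs i (restrict (map isFirst c) w) ∨ occurs i (restrict (map isSecond c) w)
occurs-notThird []           w       i = refl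
occurs-notThird (_ ∷ c)      []      i = refl
occurs-notThird (first ∷ c)  (a ∷ w) i =
  trans (cong (does (i ≟ a) ∨_) (occurs-notThird c w i))
        (sym (∨-assoc (does (i ≟ a)) (occurs i (restrict (map isFirst c) w))
                                     (occurs i (restrict (map isSecond c) w))))
occurs-notThird (second ∷ c) (a ∷ w) i =
  trans (cong (does (i ≟ a) ∨_) (occurs-notThird c w i))
        (∨-swap (does (i ≟ a)) (occurs i (restrict (map isFirst c) w))
                               (occurs i (restrict (map isSecond c) w)))
  where
  ∨-swap : ∀ p q r → p ∨ (q ∨ r) ≡ q ∨ (p ∨ r)
  ∨-swap true  true  r = refl
  ∨-swap true  false r = refl
  ∨-swap false q     r = refl
occurs-notThird (third ∷ c)  (a ∷ w) i = occurs-notThird c w i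

restrict-restrict : ∀ {I K J} w → I ⊙ K ≡ J → restrict K (restrict I w) ≡ restrict J w
restrict-restrict {I} {K} w I⊙K≡J = trans (restrict-⊙ I K w) (cong (λ L → restrict L w) I⊙K≡J)

restrict-restrict-quotient : ∀ {I K J} w s → I ⊙ K ≡ J →
  restrict K (restrict I w /w s) ≡ (restrict J w /w s)
restrict-restrict-quotient {I} {K} w s I⊙K≡J =
  trans (restrict-map (erase s) K (restrict I w)) (cong (_/w s) (restrict-restrict w I⊙K≡J))

front back : Word → List Bool → Word
front w I = pack (restrict I w)
back  w I = pack (restrict (map not I) w /w restrict I w)

restrict-none : ∀ w → restrict (replicate (length w) false) w ≡ []
restrict-none []      = refl
restrict-none (_ ∷ w) = restrict-none w

restrict-all : ∀ w → restrict (replicate (length w) true) w ≡ w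
restrict-all []      = refl
restrict-all (a ∷ w) = cong (a ∷_) (restrict-all w)

back-∅ : ∀ w → IsPacked w → back w (replicate (length w) false) ≡ w
back-∅ w packed = begin
  pack (restrict (map not (replicate n false)) w /w restrict (replicate n false) w)
    ≡⟨ cong₂ (λ L v → pack (restrict L w /w v)) (map-replicate not n false) (restrict-none w) ⟩
  pack (restrict (replicate n true) w /w [])  ≡⟨ cong (λ v → pack (v /w [])) (restrict-all w) ⟩
  pack (w /w [])                              ≡⟨ cong pack (map-id w) ⟩
  pack w                                      ≡⟨ packed ⟩
  w                                           ∎
  where
  open ≡-Reasoning
  n : ℕ
  n = length w

front-full : ∀ w → IsPacked w → front w (replicate (length w) true) ≡ w
front-full w packed = trans (cong pack (restrict-all w)) packed

termL termR : Word → List Bool → List Bool → Word × Word × Word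
termL w I K = front (front w I) K , back (front w I) K , back w I
termR w I K = front w I , front (back w I) K , back (back w I) K

coloured : Word → List Colour → Word × Word × Word
coloured w c = pack w₁ , pack (w₂ /w w₁) , pack ((w₃ /w w₁) /w (w₂ /w w₁))
  where
  w₁ w₂ w₃ : Word
  w₁ = restrict (map isFirst c) w
  w₂ = restrict (map isSecond c) w
  w₃ = restrict (map isThird c) w

termL-coloured : ∀ w c → termL w (map notThird c) (selFirst c) ≡ coloured w c
termL-coloured w c = cong₂ _,_ first-factor (cong₂ _,_ second-factor third-factor)
  where
  open ≡-Reasoning
  I K : List Bool
  I = map notThird c
  K = selFirst c
  w₁ w₂ w₃ wI : Word
  w₁ = restrict (map isFirst c) w
  w₂ = restrict (map isSecond c) w
  w₃ = restrict (map isThird c) w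
  wI = restrict I w
  first-factor : front (front w I) K ≡ pack w₁
  first-factor = begin
    pack (restrict K (pack wI))  ≡⟨ pack-restrict-pack K wI ⟩
    pack (restrict K wI)         ≡⟨ cong pack (restrict-restrict w (notThird-⊙-selFirst c)) ⟩
    pack w₁                      ∎
  second-factor : back (front w I) K ≡ pack (w₂ /w w₁)
  second-factor = begin
    pack (restrict (map not K) (pack wI) /w restrict K (pack wI)) ≡⟨ pack-quotient-pack (map not K) K wI ⟩
    pack (restrict (map not K) wI /w restrict K wI)
      ≡⟨ cong₂ (λ a b → pack (a /w b)) (restrict-restrict w (notThird-⊙-¬selFirst c))
                                         (restrict-restrict w (notThird-⊙-selFirst c)) ⟩
    pack (w₂ /w w₁)                                               ∎
  third-factor : back w I ≡ pack ((w₃ /w w₁) /w (w₂ /w w₁))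
  third-factor = begin
    pack (restrict (map not I) w /w wI)  ≡⟨ cong (λ L → pack (restrict L w /w wI)) (¬notThird c) ⟩
    pack (w₃ /w wI)                      ≡⟨ cong pack (quotient-quotient w₃ w₁ w₂ wI (occurs-notThird c w)) ⟨
    pack ((w₃ /w w₁) /w (w₂ /w w₁))      ∎

termR-coloured : ∀ w c → termR w (map isFirst c) (selSecond c) ≡ coloured w c
termR-coloured w c = cong₂ _,_ refl (cong₂ _,_ second-factor third-factor)
  where
  open ≡-Reasoning
  I K : List Bool
  I = map isFirst c
  K = selSecond c
  w₁ w₂ w₃ Z : Word
  w₁ = restrict I w
  w₂ = restrict (map isSecond c) w
  w₃ = restrict (map isThird c) w
  Z  = restrict (map not I) w /w w₁
  second-factor : front (back w I) K ≡ pack (w₂ /w w₁)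
  second-factor = begin
    pack (restrict K (pack Z))  ≡⟨ pack-restrict-pack K Z ⟩
    pack (restrict K Z)         ≡⟨ cong pack (restrict-restrict-quotient w w₁ (¬first-⊙-selSecond c)) ⟩
    pack (w₂ /w w₁)             ∎
  third-factor : back (back w I) K ≡ pack ((w₃ /w w₁) /w (w₂ /w w₁))
  third-factor = begin
    pack (restrict (map not K) (pack Z) /w restrict K (pack Z)) ≡⟨ pack-quotient-pack (map not K) K Z ⟩
    pack (restrict (map not K) Z /w restrict K Z)
      ≡⟨ cong₂ (λ a b → pack (a /w b)) (restrict-restrict-quotient w w₁ (¬first-⊙-¬selSecond c))
                                         (restrict-restrict-quotient w w₁ (¬first-⊙-selSecond c)) ⟩
    pack ((w₃ /w w₁) /w (w₂ /w w₁))                             ∎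

extendColour : List Colour → List (List Colour)
extendColour c = (first ∷ c) ∷ (second ∷ c) ∷ (third ∷ c) ∷ []

colourings : ℕ → List (List Colour)
colourings zero    = [ [] ]
colourings (suc n) = concatMap extendColour (colourings n)

enumerate : ∀ {X : Set} (splits : Word → List X) (extend : X → List X) (label : List Colour → X) →
  splits [] ≡ [ label [] ] →
  (∀ a w → splits (a ∷ w) ↭ concatMap extend (splits w)) →
  (∀ c → map label (extendColour c) ≡ extend (label c)) →
  ∀ w → splits w ↭ map label (colourings (length w))
enumerate splits extend label base step compat []      = ↭-reflexive base
enumerate splits extend label base step compat (a ∷ w) = begin
  splits (a ∷ w)                                  ↭⟨ step a w ⟩
  concatMap extend (splits w)                     ↭⟨ concatMap⁺ extend (enumerate splits extend label base step compat w) ⟩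
  concatMap extend (map label C)                  ≡⟨ concatMap-map extend label C ⟩
  concatMap (extend ∘ label) C                    ≡⟨ concatMap-cong compat C ⟨
  concatMap (map label ∘ extendColour) C          ≡⟨ map-concatMap label extendColour C ⟨
  map label (concatMap extendColour C)            ∎
  where
  open PermutationReasoning
  C : List (List Colour)
  C = colourings (length w)

-- subsets (suc n) = concatMap extendSubset (subsets n).
extendSubset : List Bool → List (List Bool)
extendSubset s = (true ∷ s) ∷ (false ∷ s) ∷ []

-- The index pairs (I , K) of (Δ ⊗ id) ∘ Δ: I ⊆ [1…|w|] and K ⊆ I.
splitsL : Word → List (List Bool × List Bool)
splitsL w = concatMap (λ I → map (I ,_) (subsets (length (restrict I w)))) (subsets (length w))

-- The index pairs (I , K) of (id ⊗ Δ) ∘ Δ: I ⊆ [1…|w|] and K ⊆ complement of I.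
splitsR : Word → List (List Bool × List Bool)
splitsR w = concatMap (λ I → map (I ,_) (subsets (length (restrict (map not I) w)))) (subsets (length w))

-- How the index pairs of the two sides grow when a letter is added in front:
-- for (Δ ⊗ id) ∘ Δ the new position goes to I and K, to I only, or to neither;
-- for (id ⊗ Δ) ∘ Δ it goes to I, to K only, or to neither.
extendL extendR : List Bool × List Bool → List (List Bool × List Bool)
extendL (I , K) = (true ∷ I , true ∷ K) ∷ (true ∷ I , false ∷ K) ∷ (false ∷ I , K) ∷ []
extendR (I , K) = (true ∷ I , K) ∷ (false ∷ I , true ∷ K) ∷ (false ∷ I , false ∷ K) ∷ []

splitsL-step : ∀ a w → splitsL (a ∷ w) ↭ concatMap extendL (splitsL w)
splitsL-step a w = begin
  splitsL (a ∷ w)                                        ≡⟨ concatMap-concatMap F extendSubset Is ⟩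
  concatMap (λ s → F (true ∷ s) ++ F (false ∷ s) ++ []) Is ↭⟨ concatMap-pointwise Is extendₛ ⟩
  concatMap (λ s → concatMap (extendL ∘ (s ,_)) (Ks s)) Is ≡⟨ concatMap-cong (λ s → concatMap-map extendL (s ,_) (Ks s)) Is ⟨
  concatMap (λ s → concatMap extendL (map (s ,_) (Ks s))) Is ≡⟨ concatMap-concatMap extendL _ Is ⟨
  concatMap extendL (splitsL w)                          ∎
  where
  open PermutationReasoning
  Is : List (List Bool)
  Is = subsets (length w)
  Ks : List Bool → List (List Bool)
  Ks s = subsets (length (restrict s w))
  F : List Bool → List (List Bool × List Bool)
  F I = map (I ,_) (subsets (length (restrict I (a ∷ w))))
  extendₛ : ∀ s → F (true ∷ s) ++ F (false ∷ s) ++ [] ↭ concatMap (extendL ∘ (s ,_)) (Ks s)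
  extendₛ s = begin
    F (true ∷ s) ++ F (false ∷ s) ++ []
      ≡⟨ cong₂ _++_ (map-concatMap (true ∷ s ,_) extendSubset (Ks s))
                    (trans (++-identityʳ (F (false ∷ s))) (map-as-concatMap (false ∷ s ,_) (Ks s))) ⟩
    concatMap (λ K → (true ∷ s , true ∷ K) ∷ (true ∷ s , false ∷ K) ∷ []) (Ks s)
      ++ concatMap (λ K → [ false ∷ s , K ]) (Ks s)
      ↭⟨ concatMap-interleave _ _ (Ks s) ⟩
    concatMap (extendL ∘ (s ,_)) (Ks s) ∎

splitsR-step : ∀ a w → splitsR (a ∷ w) ↭ concatMap extendR (splitsR w)
splitsR-step a w = begin
  splitsR (a ∷ w)                                        ≡⟨ concatMap-concatMap F extendSubset Is ⟩
  concatMap (λ s → F (true ∷ s) ++ F (false ∷ s) ++ []) Is ↭⟨ concatMap-pointwise Is extendₛ ⟩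
  concatMap (λ s → concatMap (extendR ∘ (s ,_)) (Ks s)) Is ≡⟨ concatMap-cong (λ s → concatMap-map extendR (s ,_) (Ks s)) Is ⟨
  concatMap (λ s → concatMap extendR (map (s ,_) (Ks s))) Is ≡⟨ concatMap-concatMap extendR _ Is ⟨
  concatMap extendR (splitsR w)                          ∎
  where
  open PermutationReasoning
  Is : List (List Bool)
  Is = subsets (length w)
  Ks : List Bool → List (List Bool)
  Ks s = subsets (length (restrict (map not s) w))
  F : List Bool → List (List Bool × List Bool)
  F I = map (I ,_) (subsets (length (restrict (map not I) (a ∷ w))))
  extendₛ : ∀ s → F (true ∷ s) ++ F (false ∷ s) ++ [] ↭ concatMap (extendR ∘ (s ,_)) (Ks s)
  extendₛ s = begin
    F (true ∷ s) ++ F (false ∷ s) ++ []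
      ≡⟨ cong₂ _++_ (map-as-concatMap (true ∷ s ,_) (Ks s))
                    (trans (++-identityʳ (F (false ∷ s))) (map-concatMap (false ∷ s ,_) extendSubset (Ks s))) ⟩
    concatMap (λ K → [ true ∷ s , K ]) (Ks s)
      ++ concatMap (λ K → (false ∷ s , true ∷ K) ∷ (false ∷ s , false ∷ K) ∷ []) (Ks s)
      ↭⟨ concatMap-interleave _ _ (Ks s) ⟩
    concatMap (extendR ∘ (s ,_)) (Ks s) ∎

labelL labelR : List Colour → List Bool × List Bool
labelL c = map notThird c , selFirst c
labelR c = map isFirst c , selSecond c

splitsL-colourings : ∀ w → splitsL w ↭ map labelL (colourings (length w))
splitsL-colourings = enumerate splitsL extendL labelL refl splitsL-step (λ c → refl)

splitsR-colourings : ∀ w → splitsR w ↭ map labelR (colourings (length w))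
splitsR-colourings = enumerate splitsR extendR labelR refl splitsR-step (λ c → refl)

module Laws {c ℓ : Level} (F : Field c ℓ) where
  private module R = Field F
  open R using (Carrier; _≈_; _+_; _*_; 0#; 1#)
  open Coalgebra F

  scaledΔ : Carrier → Word → T₂
  scaledΔ a w = map (λ { (x , y) → a , x , y }) (Δterms w)

  lhs-terms : ∀ a w → Δ⊗id (scaledΔ a w) ≡ map (λ { (I , K) → a , termL w I K }) (splitsL w)
  lhs-terms a w = begin
    Δ⊗id (scaledΔ a w)
      ≡⟨ concatMap-map _ _ (map _ Is) ⟩
    _ ≡⟨ concatMap-map _ _ Is ⟩
    _ ≡⟨ concatMap-cong inner Is ⟩
    concatMap (λ I → map (λ K → a , termL w I K) (subsets (length (restrict I w)))) Is
      ≡⟨ concatMap-cong (λ I → map-∘ (subsets (length (restrict I w)))) Is ⟩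
    concatMap (λ I → map T (map (I ,_) (subsets (length (restrict I w))))) Is
      ≡⟨ map-concatMap T _ Is ⟨
    map T (splitsL w) ∎
    where
    open ≡-Reasoning
    Is : List (List Bool)
    Is = subsets (length w)
    T : List Bool × List Bool → Carrier × Word × Word × Word
    T (I , K) = a , termL w I K
    inner : ∀ I → map (λ { (x , y) → a , x , y , back w I }) (Δterms (front w I))
                ≡ map (λ K → a , termL w I K) (subsets (length (restrict I w)))
    inner I = trans (sym (map-∘ (subsets (length (front w I)))))
                    (cong (λ n → map (λ K → a , termL w I K) (subsets n))
                          (length-map (φ (restrict I w)) (restrict I w)))

  rhs-terms : ∀ a w → id⊗Δ (scaledΔ a w) ≡ map (λ { (I , K) → a , termR w I K }) (splitsR w)
  rhs-terms a w = begin
    id⊗Δ (scaledΔ a w)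
      ≡⟨ concatMap-map _ _ (map _ Is) ⟩
    _ ≡⟨ concatMap-map _ _ Is ⟩
    _ ≡⟨ concatMap-cong inner Is ⟩
    concatMap (λ I → map (λ K → a , termR w I K) (Ks I)) Is
      ≡⟨ concatMap-cong (λ I → map-∘ (Ks I)) Is ⟩
    concatMap (λ I → map T (map (I ,_) (Ks I))) Is
      ≡⟨ map-concatMap T _ Is ⟨
    map T (splitsR w) ∎
    where
    open ≡-Reasoning
    Is : List (List Bool)
    Is = subsets (length w)
    Ks : List Bool → List (List Bool)
    Ks I = subsets (length (restrict (map not I) w))
    T : List Bool × List Bool → Carrier × Word × Word × Word
    T (I , K) = a , termR w I K
    length-back : ∀ I → length (back w I) ≡ length (restrict (map not I) w)
    length-back I = trans (length-map (φ Z) Z) (length-map (erase (restrict I w)) (restrict (map not I) w))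
      where
      Z : Word
      Z = restrict (map not I) w /w restrict I w
    inner : ∀ I → map (λ { (x , y) → a , front w I , x , y }) (Δterms (back w I))
                ≡ map (λ K → a , termR w I K) (Ks I)
    inner I = trans (sym (map-∘ (subsets (length (back w I)))))
                    (cong (λ n → map (λ K → a , termR w I K) (subsets n)) (length-back I))

  -- Coassociativity on a single basis word, as an equality of term lists up to order:
  -- both sides are reindexed by colourings and agree term by term.
  coassociative-word : ∀ a w → Δ⊗id (scaledΔ a w) ↭ id⊗Δ (scaledΔ a w)
  coassociative-word a w = begin
    Δ⊗id (scaledΔ a w)                              ≡⟨ lhs-terms a w ⟩
    map (uncurry TL) (splitsL w)                    ↭⟨ map⁺ (uncurry TL) (splitsL-colourings w) ⟩
    map (uncurry TL) (map labelL C)                 ≡⟨ map-∘ C ⟨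
    map (uncurry TL ∘ labelL) C                     ≡⟨ map-cong (λ c → cong (a ,_) (termL-coloured w c)) C ⟩
    map (λ c → a , coloured w c) C                  ≡⟨ map-cong (λ c → cong (a ,_) (termR-coloured w c)) C ⟨
    map (uncurry TR ∘ labelR) C                     ≡⟨ map-∘ C ⟩
    map (uncurry TR) (map labelR C)                 ↭⟨ map⁺ (uncurry TR) (splitsR-colourings w) ⟨
    map (uncurry TR) (splitsR w)                    ≡⟨ rhs-terms a w ⟨
    id⊗Δ (scaledΔ a w)                              ∎
    where
    open PermutationReasoning
    C : List (List Colour)
    C = colourings (length w)
    TL TR : List Bool → List Bool → Carrier × Word × Word × Word
    TL I K = a , termL w I K
    TR I K = a , termR w I K

  -- Coefficients are sums, so they do not depend on the order of the terms.
  coeff₃-↭ : ∀ {s t} → s ↭ t → s ≈₃ t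
  coeff₃-↭ ↭.refl         u v z = R.refl
  coeff₃-↭ (↭.prep x p)   u v z = R.+-cong R.refl (coeff₃-↭ p u v z)
  coeff₃-↭ (↭.swap x y p) u v z =
    R.trans (R.+-cong R.refl (R.+-cong R.refl (coeff₃-↭ p u v z))) (x∙yz≈y∙xz _ _ _)
    where open CommutativeSemigroupProperties R.+-commutativeSemigroup using (x∙yz≈y∙xz)
  coeff₃-↭ (↭.trans p q)  u v z = R.trans (coeff₃-↭ p u v z) (coeff₃-↭ q u v z)

  coassociative-terms : ∀ h → Δ⊗id (Δ h) ↭ id⊗Δ (Δ h)
  coassociative-terms []                  = ↭-refl
  coassociative-terms ((a , w , _) ∷ h) = begin
    Δ⊗id (scaledΔ a w ++ Δ h)              ≡⟨ concatMap-++ _ (scaledΔ a w) (Δ h) ⟩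
    Δ⊗id (scaledΔ a w) ++ Δ⊗id (Δ h)       ↭⟨ ++⁺ (coassociative-word a w) (coassociative-terms h) ⟩
    id⊗Δ (scaledΔ a w) ++ id⊗Δ (Δ h)       ≡⟨ concatMap-++ _ (scaledΔ a w) (Δ h) ⟨
    id⊗Δ (scaledΔ a w ++ Δ h)              ∎
    where open PermutationReasoning

  indicator : Word → Word → Carrier → Carrier
  indicator k u a = if does (k ≟w u) then a else 0#

  indicator-0 : ∀ k u a → indicator k u (a * 0#) ≈ 0#
  indicator-0 k u a with does (k ≟w u)
  ... | true  = R.zeroʳ a
  ... | false = R.refl

  coeff₁-++ : ∀ s t u → coeff₁ (s ++ t) u ≈ coeff₁ s u + coeff₁ t u
  coeff₁-++ []      t u = R.sym (R.+-identityˡ _)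
  coeff₁-++ (x ∷ s) t u = R.trans (R.+-cong R.refl (coeff₁-++ s t u)) (R.sym (R.+-assoc _ _ _))

  coeff₁-single : ∀ a k u → coeff₁ [ a * 1# , k ] u ≈ indicator k u a
  coeff₁-single a k u with does (k ≟w u)
  ... | true  = R.trans (R.+-identityʳ _) (R.*-identityʳ a)
  ... | false = R.+-identityʳ _

  drop-true : ∀ (g : List Bool → Carrier × Word) a (key : List Bool → Word) Is u →
    (∀ s → g (true ∷ s) ≡ (a * 0# , key s)) →
    coeff₁ (map g (concatMap extendSubset Is)) u ≈ coeff₁ (map (g ∘ (false ∷_)) Is) u
  drop-true g a key []       u zero-weight = R.refl
  drop-true g a key (s ∷ Is) u zero-weight rewrite zero-weight s =
    R.trans (R.+-cong (indicator-0 (key s) u a) R.refl)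
            (R.trans (R.+-identityˡ _) (R.+-cong R.refl (drop-true g a key Is u zero-weight)))

  drop-false : ∀ (g : List Bool → Carrier × Word) a (key : List Bool → Word) Is u →
    (∀ s → g (false ∷ s) ≡ (a * 0# , key s)) →
    coeff₁ (map g (concatMap extendSubset Is)) u ≈ coeff₁ (map (g ∘ (true ∷_)) Is) u
  drop-false g a key []       u zero-weight = R.refl
  drop-false g a key (s ∷ Is) u zero-weight rewrite zero-weight s =
    R.+-cong R.refl (R.trans (R.+-cong (indicator-0 (key s) u a) R.refl)
                             (R.trans (R.+-identityˡ _) (drop-false g a key Is u zero-weight)))

  only-empty-survives : ∀ a w (f : List Bool → Word) u →
    coeff₁ (map (λ I → a * εw (restrict I w) , f I) (subsets (length w))) u
      ≈ indicator (f (replicate (length w) false)) u a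
  only-empty-survives a []      f u = coeff₁-single a (f []) u
  only-empty-survives a (x ∷ w) f u =
    R.trans (drop-true _ a (f ∘ (true ∷_)) (subsets (length w)) u (λ s → refl))
            (only-empty-survives a w (f ∘ (false ∷_)) u)

  only-full-survives : ∀ a w (f : List Bool → Word) u →
    coeff₁ (map (λ I → a * εw (restrict (map not I) w) , f I) (subsets (length w))) u
      ≈ indicator (f (replicate (length w) true)) u a
  only-full-survives a []      f u = coeff₁-single a (f []) u
  only-full-survives a (x ∷ w) f u =
    R.trans (drop-false _ a (f ∘ (false ∷_)) (subsets (length w)) u (λ s → refl))
            (only-full-survives a w (f ∘ (true ∷_)) u)

  -- ε only sees whether a word is empty.
  εw-map : ∀ (g : ℕ → ℕ) y → εw (map g y) ≡ εw y
  εw-map g []      = refl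
  εw-map g (_ ∷ _) = refl

  counit-left-word : ∀ a w → IsPacked w → ∀ u → coeff₁ (ε⊗id (scaledΔ a w)) u ≈ indicator w u a
  counit-left-word a w packed u = begin
    coeff₁ (ε⊗id (scaledΔ a w)) u
      ≡⟨ cong (λ t → coeff₁ t u) reindex ⟩
    coeff₁ (map (λ I → a * εw (restrict I w) , back w I) (subsets (length w))) u
      ≈⟨ only-empty-survives a w (back w) u ⟩
    indicator (back w (replicate (length w) false)) u a
      ≡⟨ cong (λ k → indicator k u a) (back-∅ w packed) ⟩
    indicator w u a ∎
    where
    open import Relation.Binary.Reasoning.Setoid R.setoid
    reindex : ε⊗id (scaledΔ a w) ≡ map (λ I → a * εw (restrict I w) , back w I) (subsets (length w))
    reindex = trans (sym (map-∘ (map _ (subsets (length w)))))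
             (trans (sym (map-∘ (subsets (length w))))
                    (map-cong (λ I → cong (λ e → a * e , back w I) (εw-map _ (restrict I w))) (subsets (length w))))

  counit-right-word : ∀ a w → IsPacked w → ∀ u → coeff₁ (id⊗ε (scaledΔ a w)) u ≈ indicator w u a
  counit-right-word a w packed u = begin
    coeff₁ (id⊗ε (scaledΔ a w)) u
      ≡⟨ cong (λ t → coeff₁ t u) reindex ⟩
    coeff₁ (map (λ I → a * εw (restrict (map not I) w) , front w I) (subsets (length w))) u
      ≈⟨ only-full-survives a w (front w) u ⟩
    indicator (front w (replicate (length w) true)) u a
      ≡⟨ cong (λ k → indicator k u a) (front-full w packed) ⟩
    indicator w u a ∎
    where
    open import Relation.Binary.Reasoning.Setoid R.setoid
    ε-back : ∀ I → εw (back w I) ≡ εw (restrict (map not I) w)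
    ε-back I = trans (εw-map _ (restrict (map not I) w /w restrict I w)) (εw-map _ (restrict (map not I) w))
    reindex : id⊗ε (scaledΔ a w) ≡ map (λ I → a * εw (restrict (map not I) w) , front w I) (subsets (length w))
    reindex = trans (sym (map-∘ (map _ (subsets (length w)))))
             (trans (sym (map-∘ (subsets (length w))))
                    (map-cong (λ I → cong (λ e → a * e , front w I) (ε-back I)) (subsets (length w))))

  counit-from-words : (E : (Carrier × Word × Word) → Carrier × Word) →
    (∀ a w → IsPacked w → ∀ u → coeff₁ (map E (scaledΔ a w)) u ≈ indicator w u a) →
    ∀ h → map E (Δ h) ≈₁ ι h
  counit-from-words E on-words []                  u = R.refl
  counit-from-words E on-words ((a , w , packed) ∷ h) u = begin
    coeff₁ (map E (scaledΔ a w ++ Δ h)) u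
      ≡⟨ cong (λ t → coeff₁ t u) (map-++ E (scaledΔ a w) (Δ h)) ⟩
    coeff₁ (map E (scaledΔ a w) ++ map E (Δ h)) u
      ≈⟨ coeff₁-++ (map E (scaledΔ a w)) (map E (Δ h)) u ⟩
    coeff₁ (map E (scaledΔ a w)) u + coeff₁ (map E (Δ h)) u
      ≈⟨ R.+-cong (on-words a w packed u) (counit-from-words E on-words h u) ⟩
    indicator w u a + coeff₁ (ι h) u ∎
    where open import Relation.Binary.Reasoning.Setoid R.setoid

proposition3 : ∀ {c ℓ} (F : Field c ℓ) → let open Coalgebra F in
    (∀ (h : H) → Δ⊗id (Δ h) ≈₃ id⊗Δ (Δ h))
    × (∀ (h : H) → ε⊗id (Δ h) ≈₁ ι h)
    × (∀ (h : H) → id⊗ε (Δ h) ≈₁ ι h)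
proposition3 F =
    (λ h → coeff₃-↭ (coassociative-terms h))
  , counit-from-words _ counit-left-word
  , counit-from-words _ counit-right-word
  where open Laws F
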